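{- For all $n\in\mathbb{N}$ and all $\pi=\pi_1\pi_2\cdots\pi_n\in S_n$, \[\operatorname{sc}(\pi)=\max_{i\in[n]}\operatorname{sc}(\pi^i),\] where $\pi^i$ is the sequence obtained from $\pi_1\pi_2\cdots\pi_i$ by deleting every entry less than $\pi_i$ (equivalently, the subsequence of $\pi_1\cdots\pi_i$ consisting of entries $\ge \pi_i$).
   Context: A "permutation" here may be any finite sequence of distinct integers. West's stack-sorting map $s$ acts on such a sequence as follows: read the input from left to right with an initially empty stack; repeatedly, if the input is nonempty and either the stack is empty or the top element of the stack is greater than the next input entry, push the next input entry onto the stack; otherwise pop the top element of the stack and append it to the output; stop when both input and stack are empty. The output is $s(\pi)$. For a sequence $\pi$, $\operatorname{sc}(\pi)$ denotes the least integer $k\ge0$ such that $s^k(\pi)$ is increasing. $S_n$ is the set of permutations of $[n]=\{1,\dots,n\}$, written in one-line notation. -}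

module Defs where

open import Data.Nat using (ℕ; zero; suc; _<_; _<?_; _≤?_; _⊔_)
open import Data.Fin using (Fin; toℕ)
open import Data.List using (List; []; _∷_; length; take; filter; lookup; tabulate; foldr)
open import Data.List.Relation.Unary.Linked using (Linked; linked?)
open import Relation.Nullary.Decidable using (does)
open import Data.Bool using (if_then_else_)

-- West's stack-sorting algorithm, run directly as described in the paper:
-- `stackRun input stack` produces the output word (stack top is the head).
stackRun : List ℕ → List ℕ → List ℕ
stackRun [] [] = []
stackRun [] (y ∷ ys) = y ∷ stackRun [] ys
stackRun (x ∷ xs) [] = stackRun xs (x ∷ [])
stackRun inp@(x ∷ xs) (y ∷ ys) =
  if does (x <? y) then stackRun xs (x ∷ y ∷ ys) else (y ∷ stackRun inp ys)

s : List ℕ → List ℕ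
s π = stackRun π []

iter : ℕ → List ℕ → List ℕ
iter zero π = π
iter (suc k) π = iter k (s π)

Increasing : List ℕ → Set
Increasing = Linked _<_

-- least k in {start, ..., start + fuel} with s^k(π) increasing
-- (returns start + fuel if none is found)
search : ℕ → ℕ → List ℕ → ℕ
search start zero π = start
search start (suc fuel) π =
  if does (linked? _<?_ (iter start π)) then start else search (suc start) fuel π

-- sc(π): least k ≥ 0 with s^k(π) increasing. For a sequence of length n
-- of distinct entries, s^n(π) is increasing, so searching k ∈ {0,…,n} suffices.
sc : List ℕ → ℕ
sc π = search 0 (length π) π

-- π^i for i ∈ [n] (0-based index i here, i.e. paper's i+1): the subsequence of
-- π_1 … π_(i+1) consisting of entries ≥ π_(i+1).
sup : (π : List ℕ) → Fin (length π) → List ℕ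
sup π i = filter (λ x → lookup π i ≤? x) (take (suc (toℕ i)) π)

maximum : List ℕ → ℕ
maximum = foldr _⊔_ 0

maxScSup : List ℕ → ℕ
maxScSup π = maximum (tabulate {n = length π} (λ i → sc (sup π i)))

{-# OPTIONS --safe #-}
module Submission where

-- Filtering out the entries below a threshold commutes with s.  If t is smaller than every
-- other entry of X ++ t ∷ Y, then s (X ++ t ∷ Y) = front X ++ t ∷ R, where front X, the output
-- produced while X is read, depends on X alone.  Hence the entries larger than π_i standing
-- before π_i in s^k π are front^k applied to the entries larger than π_i among π_1 … π_(i-1),
-- and s^k π is increasing iff all of these lists are empty.  The condition at π_i is the same
-- for π and for π^i, and the conditions for π^i are among those for π; so sc π ≤ k iff
-- sc π^i ≤ k for every i.

open import Defs
open import Data.Bool using (true; false; if_then_else_)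
open import Data.Fin using (Fin; toℕ; zero; suc)
open import Data.List
  using (List; []; _∷_; _++_; [_]; filter; head; length; take; drop; lookup; tabulate; map; upTo)
open import Data.List.Properties
  using (filter-accept; filter-reject; filter-++; filter-idem; length-filter; length-++; length-++-≤ˡ;
         ++-assoc; ++-identityʳ; ∷-injective; take++drop≡id; foldr-forcesᵇ; foldr-preservesᵇ)
open import Data.List.Membership.Propositional using (_∈_)
open import Data.List.Membership.Propositional.Properties using (∈-∃++; ∈-insert)
open import Data.List.Relation.Binary.Permutation.Propositional
  using (_↭_; ↭-refl; ↭-sym; ↭-trans; ↭-prep; ↭-reflexive; ↭⇒↭ₛ)
open import Data.List.Relation.Binary.Permutation.Propositional.Properties
  using (shift; All-resp-↭; ∈-resp-↭; ↭-length)
import Data.List.Relation.Binary.Permutation.Setoid.Properties as ↭ₛ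
open import Data.List.Relation.Unary.All using (All; []; _∷_)
import Data.List.Relation.Unary.All as All
open import Data.List.Relation.Unary.All.Properties using (++⁺; ++⁻; all-filter; tabulate⁺; tabulate⁻)
import Data.List.Relation.Unary.All.Properties as All
open import Data.List.Relation.Unary.AllPairs using (AllPairs; []; _∷_)
open import Data.List.Relation.Unary.Any using (here; there)
open import Data.List.Relation.Unary.Linked using (linked?)
open import Data.List.Relation.Unary.Linked.Properties using (AllPairs⇒Linked; Linked⇒AllPairs)
open import Data.List.Relation.Unary.Unique.Propositional using (Unique)
import Data.List.Relation.Unary.Unique.Propositional.Properties as Unique
open import Data.Maybe using (just)
open import Data.Maybe.Properties using (just-injective)
open import Data.Nat
  using (ℕ; zero; suc; _+_; _∸_; _<_; _≤_; _≮_; _<ᵇ_; _<?_; _≤?_; _⊔_; z≤n; s≤s)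
open import Data.Nat.Properties
open import Data.Product using (∃; ∃₂; _×_; _,_; proj₁; proj₂)
open import Function.Base using (flip)
open import Function.Bundles using (_⇔_; mk⇔; Equivalence)
open import Function.Construct.Composition using (_⇔-∘_)
open import Function.Construct.Symmetry using (⇔-sym)
open import Level using (0ℓ)
open import Relation.Binary.PropositionalEquality
  using (_≡_; _≢_; refl; sym; trans; cong; cong₂; subst; setoid; module ≡-Reasoning)
open import Relation.Nullary using (yes; no; does; contradiction)
open import Relation.Nullary.Reflects using (ofʸ; ofⁿ)
open import Relation.Unary using (Pred; Decidable; _⊆_)

Unique-resp-↭ : ∀ {A : Set} {xs ys : List A} → xs ↭ ys → Unique xs → Unique ys
Unique-resp-↭ {A} p = ↭ₛ.Unique-resp-↭ (setoid A) (↭⇒↭ₛ p)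

Unique-middle : ∀ {A : Set} {t : A} xs ys → Unique (xs ++ t ∷ ys) →
                All (t ≢_) xs × All (t ≢_) ys
Unique-middle {t = t} xs ys u with t∉ ∷ _ ← Unique-resp-↭ (shift t xs ys) u = ++⁻ xs t∉

module _ {A : Set} {P Q : Pred A 0ℓ} (P? : Decidable P) (Q? : Decidable Q) where

  filter-filter-⊆ : P ⊆ Q → ∀ xs → filter P? (filter Q? xs) ≡ filter P? xs
  filter-filter-⊆ P⊆Q [] = refl
  filter-filter-⊆ P⊆Q (x ∷ xs) with Q? x
  ... | no ¬Qx = trans (filter-filter-⊆ P⊆Q xs) (sym (filter-reject P? (λ Px → ¬Qx (P⊆Q Px))))
  ... | yes _ with P? x
  ...   | yes _ = cong (x ∷_) (filter-filter-⊆ P⊆Q xs)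
  ...   | no _  = filter-filter-⊆ P⊆Q xs

module _ {A : Set} {P : Pred A 0ℓ} (P? : Decidable P) where

  filter-split : ∀ {t B′} xs A′ → filter P? xs ≡ A′ ++ t ∷ B′ →
                 ∃₂ λ xs₁ xs₂ → xs ≡ xs₁ ++ t ∷ xs₂ × filter P? xs₁ ≡ A′ × P t
  filter-split [] [] ()
  filter-split [] (_ ∷ _) ()
  filter-split (x ∷ xs) A′ eq with P? x
  filter-split (x ∷ xs) [] refl | yes Px = [] , xs , refl , refl , Px
  filter-split (x ∷ xs) (a ∷ A′) eq | yes Px with refl , eq′ ← ∷-injective eq
      with xs₁ , xs₂ , refl , fxs₁ , Pt ← filter-split xs A′ eq′
    = x ∷ xs₁ , xs₂ , refl , trans (filter-accept P? Px) (cong (x ∷_) fxs₁) , Pt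
  filter-split (x ∷ xs) A′ eq | no ¬Px with xs₁ , xs₂ , refl , fxs₁ , Pt ← filter-split xs A′ eq
    = x ∷ xs₁ , xs₂ , refl , trans (filter-reject P? ¬Px) fxs₁ , Pt

-- Stack sorting permutes its input and commutes with upward-closed filters

-- `does (x <? y)` computes to `x <ᵇ y`, so that is the term `with` has to abstract.
stackRun-push : ∀ {x y} xs ys → x < y → stackRun (x ∷ xs) (y ∷ ys) ≡ stackRun xs (x ∷ y ∷ ys)
stackRun-push {x} {y} xs ys x<y with x <ᵇ y | <ᵇ-reflects-< x y
... | true  | _       = refl
... | false | ofⁿ x≮y = contradiction x<y x≮y

stackRun-pop : ∀ {x y} xs ys → x ≮ y → stackRun (x ∷ xs) (y ∷ ys) ≡ y ∷ stackRun (x ∷ xs) ys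
stackRun-pop {x} {y} xs ys x≮y with x <ᵇ y | <ᵇ-reflects-< x y
... | true  | ofʸ x<y = contradiction x<y x≮y
... | false | _       = refl

stackRun-[] : ∀ stk → stackRun [] stk ≡ stk
stackRun-[] []       = refl
stackRun-[] (y ∷ ys) = cong (y ∷_) (stackRun-[] ys)

-- The local `reading` recurses on the stack under a fixed input head: a lexicographic
-- recursion on (input, stack) would not pass the termination checker through `with`.
stackRun-↭ : ∀ inp stk → stackRun inp stk ↭ inp ++ stk
stackRun-↭ []       stk = ↭-reflexive (stackRun-[] stk)
stackRun-↭ (x ∷ xs)     = reading
  where
  reading : ∀ stk → stackRun (x ∷ xs) stk ↭ x ∷ xs ++ stk
  reading [] = ↭-trans (stackRun-↭ xs [ x ]) (shift x xs [])
  reading (y ∷ ys) with x <ᵇ y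
  ... | true  = ↭-trans (stackRun-↭ xs (x ∷ y ∷ ys)) (shift x xs (y ∷ ys))
  ... | false = ↭-trans (↭-prep y (reading ys)) (↭-sym (shift y (x ∷ xs) ys))

s-↭ : ∀ π → s π ↭ π
s-↭ π = ↭-trans (stackRun-↭ π []) (↭-reflexive (++-identityʳ π))

iter-↭ : ∀ k π → iter k π ↭ π
iter-↭ zero    π = ↭-refl
iter-↭ (suc k) π = ↭-trans (iter-↭ k (s π)) (s-↭ π)

module _ {P : Pred ℕ 0ℓ} (P? : Decidable P) (upward : ∀ {a b} → a ≤ b → P a → P b) where

  private
    F : List ℕ → List ℕ
    F = filter P?

  stackRun-filter-push : ∀ {x y} xs ys → x < y →
                         stackRun (F xs) (F (x ∷ y ∷ ys)) ≡ stackRun (F (x ∷ xs)) (F (y ∷ ys))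
  stackRun-filter-push {x} {y} xs ys x<y with P? x
  ... | no _ = refl
  ... | yes Px with P? y
  ...   | yes _  = sym (stackRun-push (F xs) (F ys) x<y)
  ...   | no ¬Py = contradiction (upward (<⇒≤ x<y) Px) ¬Py

  stackRun-filter-pop : ∀ {x y} xs ys → x ≮ y →
                        F (stackRun (x ∷ xs) ys) ≡ stackRun (F (x ∷ xs)) (F ys) →
                        F (y ∷ stackRun (x ∷ xs) ys) ≡ stackRun (F (x ∷ xs)) (F (y ∷ ys))
  stackRun-filter-pop {x} {y} xs ys x≮y eq with P? y | P? x
  ... | yes _  | yes _  = trans (cong (y ∷_) eq) (sym (stackRun-pop (F xs) (F ys) x≮y))
  ... | yes Py | no ¬Px = contradiction (upward (≮⇒≥ x≮y) Py) ¬Px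
  ... | no _   | _      = eq

  stackRun-filter : ∀ inp stk → F (stackRun inp stk) ≡ stackRun (F inp) (F stk)
  stackRun-filter []       stk = trans (cong F (stackRun-[] stk)) (sym (stackRun-[] (F stk)))
  stackRun-filter (x ∷ xs)     = reading
    where
    reading : ∀ stk → F (stackRun (x ∷ xs) stk) ≡ stackRun (F (x ∷ xs)) (F stk)
    reading [] with P? x | stackRun-filter xs [ x ]
    ... | yes _ | eq = eq
    ... | no _  | eq = eq
    reading (y ∷ ys) with x <ᵇ y | <ᵇ-reflects-< x y
    ... | true  | ofʸ x<y = trans (stackRun-filter xs (x ∷ y ∷ ys)) (stackRun-filter-push xs ys x<y)
    ... | false | ofⁿ x≮y = stackRun-filter-pop xs ys x≮y (reading ys)

  iter-filter : ∀ k π → F (iter k π) ≡ iter k (F π)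
  iter-filter zero    π = refl
  iter-filter (suc k) π = trans (iter-filter k (s π)) (cong (iter k) (stackRun-filter π []))

-- The output in front of a new minimum

emitted : List ℕ → List ℕ → List ℕ
emitted [] stk = []
emitted (x ∷ xs) [] = emitted xs [ x ]
emitted inp@(x ∷ xs) (y ∷ ys) =
  if does (x <? y) then emitted xs (x ∷ y ∷ ys) else (y ∷ emitted inp ys)

leftOnStack : List ℕ → List ℕ → List ℕ
leftOnStack [] stk = stk
leftOnStack (x ∷ xs) [] = leftOnStack xs [ x ]
leftOnStack inp@(x ∷ xs) (y ∷ ys) =
  if does (x <? y) then leftOnStack xs (x ∷ y ∷ ys) else leftOnStack inp ys

stackRun-++ : ∀ X Z stk → stackRun (X ++ Z) stk ≡ emitted X stk ++ stackRun Z (leftOnStack X stk)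
stackRun-++ []       Z stk = refl
stackRun-++ (x ∷ xs) Z     = reading
  where
  reading : ∀ stk → stackRun (x ∷ xs ++ Z) stk
                  ≡ emitted (x ∷ xs) stk ++ stackRun Z (leftOnStack (x ∷ xs) stk)
  reading [] = stackRun-++ xs Z [ x ]
  reading (y ∷ ys) with x <ᵇ y
  ... | true  = stackRun-++ xs Z (x ∷ y ∷ ys)
  ... | false = cong (y ∷_) (reading ys)

stackRun-emitted : ∀ X stk → stackRun X stk ≡ emitted X stk ++ leftOnStack X stk
stackRun-emitted X stk = begin
  stackRun X stk                                    ≡⟨ cong (λ inp → stackRun inp stk) (++-identityʳ X) ⟨
  stackRun (X ++ []) stk                            ≡⟨ stackRun-++ X [] stk ⟩
  emitted X stk ++ stackRun [] (leftOnStack X stk)  ≡⟨ cong (emitted X stk ++_) (stackRun-[] _) ⟩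
  emitted X stk ++ leftOnStack X stk                ∎
  where open ≡-Reasoning

emitted-↭ : ∀ X stk → emitted X stk ++ leftOnStack X stk ↭ X ++ stk
emitted-↭ X stk = subst (_↭ X ++ stk) (stackRun-emitted X stk) (stackRun-↭ X stk)

module _ {P : Pred ℕ 0ℓ} where

  emitted-All : ∀ {X stk} → All P X → All P stk →
                All P (emitted X stk) × All P (leftOnStack X stk)
  emitted-All {X} {stk} PX Pstk = ++⁻ _ (All-resp-↭ (↭-sym (emitted-↭ X stk)) (++⁺ PX Pstk))

  stackRun-All : ∀ {inp stk} → All P inp → All P stk → All P (stackRun inp stk)
  stackRun-All {inp} {stk} Pinp Pstk = All-resp-↭ (↭-sym (stackRun-↭ inp stk)) (++⁺ Pinp Pstk)

leftOnStack-nonempty : ∀ X y ys → 0 < length (leftOnStack X (y ∷ ys))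
leftOnStack-nonempty []       y ys = s≤s z≤n
leftOnStack-nonempty (x ∷ xs)      = reading
  where
  reading : ∀ y ys → 0 < length (leftOnStack (x ∷ xs) (y ∷ ys))
  reading y ys with x <ᵇ y
  reading y ys       | true  = leftOnStack-nonempty xs x (y ∷ ys)
  reading y []       | false = leftOnStack-nonempty xs x []
  reading y (z ∷ zs) | false = reading z zs

front : List ℕ → List ℕ
front X = emitted X []

frontIter : ℕ → List ℕ → List ℕ
frontIter zero    X = X
frontIter (suc k) X = frontIter k (front X)

front-shorter : ∀ x xs → length (front (x ∷ xs)) ≤ length xs
front-shorter x xs = ≤-pred (begin-strict
  length (emitted xs [ x ])                                  <⟨ m<m+n _ (leftOnStack-nonempty xs x []) ⟩
  length (emitted xs [ x ]) + length (leftOnStack xs [ x ])  ≡⟨ length-++ (emitted xs [ x ]) ⟨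
  length (emitted xs [ x ] ++ leftOnStack xs [ x ])          ≡⟨ ↭-length (emitted-↭ xs [ x ]) ⟩
  length (xs ++ [ x ])                                       ≡⟨ length-++ xs ⟩
  length xs + 1                                              ≡⟨ +-comm (length xs) 1 ⟩
  suc (length xs)                                            ∎)
  where open ≤-Reasoning

frontIter-[] : ∀ k → frontIter k [] ≡ []
frontIter-[] zero    = refl
frontIter-[] (suc k) = frontIter-[] k

frontIter-+ : ∀ a d X → frontIter (a + d) X ≡ frontIter d (frontIter a X)
frontIter-+ zero    d X = refl
frontIter-+ (suc a) d X = frontIter-+ a d (front X)

frontIter-mono : ∀ {a b} X → a ≤ b → frontIter a X ≡ [] → frontIter b X ≡ []
frontIter-mono {a} {b} X a≤b done = begin
  frontIter b X                      ≡⟨ cong (λ m → frontIter m X) (m+[n∸m]≡n a≤b) ⟨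
  frontIter (a + (b ∸ a)) X          ≡⟨ frontIter-+ a (b ∸ a) X ⟩
  frontIter (b ∸ a) (frontIter a X)  ≡⟨ cong (frontIter (b ∸ a)) done ⟩
  frontIter (b ∸ a) []               ≡⟨ frontIter-[] (b ∸ a) ⟩
  []                                 ∎
  where open ≡-Reasoning

frontIter-length : ∀ k X → length X ≤ k → frontIter k X ≡ []
frontIter-length zero    []       _         = refl
frontIter-length (suc k) []       _         = frontIter-[] k
frontIter-length (suc k) (x ∷ xs) (s≤s len) =
  frontIter-length k (front (x ∷ xs)) (≤-trans (front-shorter x xs) len)

frontIter-All : ∀ {P : Pred ℕ 0ℓ} k {X} → All P X → All P (frontIter k X)
frontIter-All zero    PX = PX
frontIter-All (suc k) PX = frontIter-All k (proj₁ (emitted-All PX []))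

stackRun-below : ∀ {t} Y S → All (t <_) Y → stackRun Y (t ∷ S) ≡ t ∷ stackRun Y S
stackRun-below []      S _         = refl
stackRun-below (y ∷ Y) S (t<y ∷ _) = stackRun-pop Y S (<⇒≯ t<y)

stackRun-min : ∀ {t} Y S → All (t <_) Y → All (t <_) S → stackRun (t ∷ Y) S ≡ t ∷ stackRun Y S
stackRun-min Y []      tY _         = stackRun-below Y [] tY
stackRun-min Y (x ∷ S) tY (t<x ∷ _) = trans (stackRun-push Y S t<x) (stackRun-below Y (x ∷ S) tY)

s-split : ∀ {t} X Y → All (t <_) X → All (t <_) Y →
          ∃ λ R → All (t <_) R × s (X ++ t ∷ Y) ≡ front X ++ t ∷ R
s-split {t} X Y tX tY = stackRun Y rest , stackRun-All tY trest , (begin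
  stackRun (X ++ t ∷ Y) []          ≡⟨ stackRun-++ X (t ∷ Y) [] ⟩
  front X ++ stackRun (t ∷ Y) rest  ≡⟨ cong (front X ++_) (stackRun-min Y rest tY trest) ⟩
  front X ++ t ∷ stackRun Y rest    ∎)
  where
  open ≡-Reasoning
  rest : List ℕ
  rest = leftOnStack X []
  trest : All (t <_) rest
  trest = proj₂ (emitted-All tX [])

iter-split : ∀ {t} k X Y → All (t <_) X → All (t <_) Y →
             ∃ λ R → iter k (X ++ t ∷ Y) ≡ frontIter k X ++ t ∷ R
iter-split zero    X Y _  _  = Y , refl
iter-split (suc k) X Y tX tY with s-split X Y tX tY
... | R , tR , eq with iter-split k (front X) R (proj₁ (emitted-All tX [])) tR
...   | R′ , eq′ = R′ , trans (cong (iter k) eq) eq′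

upper : ℕ → List ℕ → List ℕ
upper t = filter (t ≤?_)

upper-self : ∀ t L → upper t (t ∷ L) ≡ t ∷ upper t L
upper-self t L = filter-accept (t ≤?_) ≤-refl

upper-above : ∀ {t} A → All (t ≢_) A → All (t <_) (upper t A)
upper-above {t} A t∉A = All.zipWith (λ (t≤a , t≢a) → ≤∧≢⇒< t≤a t≢a)
  (all-filter (t ≤?_) A , All.filter⁺ (t ≤?_) t∉A)

sorted⇒upper-head : ∀ {t L} → AllPairs _<_ L → t ∈ L → head (upper t L) ≡ just t
sorted⇒upper-head {t} {t ∷ L} _ (here refl) = cong head (upper-self t L)
sorted⇒upper-head {t} {x ∷ L} (x<L ∷ sorted) (there t∈L) =
  trans (cong head (filter-reject (t ≤?_) (<⇒≱ (All.lookup x<L t∈L)))) (sorted⇒upper-head sorted t∈L)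

upper-head⇒sorted : ∀ {L} → Unique L → (∀ {t} → t ∈ L → head (upper t L) ≡ just t) →
                    AllPairs _<_ L
upper-head⇒sorted {[]}    _          _     = []
upper-head⇒sorted {x ∷ L} (x∉L ∷ uL) heads = x<L ∷ upper-head⇒sorted uL heads′
  where
  -- If t ≤ x for a later entry t, then upper t (x ∷ L) would start with x ≠ t.
  x<L : All (x <_) L
  x<L = All.tabulate λ {t} t∈L → ≰⇒> λ t≤x → All.lookup x∉L t∈L (just-injective (begin
    just x                     ≡⟨ cong head (filter-accept (t ≤?_) t≤x) ⟨
    head (upper t (x ∷ L))     ≡⟨ heads (there t∈L) ⟩
    just t                     ∎))
    where open ≡-Reasoning
  heads′ : ∀ {t} → t ∈ L → head (upper t L) ≡ just t
  heads′ {t} t∈L =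
    trans (cong head (sym (filter-reject (t ≤?_) (<⇒≱ (All.lookup x<L t∈L))))) (heads (there t∈L))

upper-iter-split : ∀ k (A : List ℕ) t B → Unique (A ++ t ∷ B) →
                   All (t <_) (upper t A) ×
                   ∃ λ R → upper t (iter k (A ++ t ∷ B)) ≡ frontIter k (upper t A) ++ t ∷ R
upper-iter-split k A t B u with t∉A , t∉B ← Unique-middle A B u
    with R , eq ← iter-split k (upper t A) (upper t B) (upper-above A t∉A) (upper-above B t∉B)
  = upper-above A t∉A , R , (begin
    upper t (iter k (A ++ t ∷ B))          ≡⟨ iter-filter (t ≤?_) (flip ≤-trans) k (A ++ t ∷ B) ⟩
    iter k (upper t (A ++ t ∷ B))          ≡⟨ cong (iter k) (filter-++ (t ≤?_) A (t ∷ B)) ⟩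
    iter k (upper t A ++ upper t (t ∷ B))  ≡⟨ cong (λ C → iter k (upper t A ++ C)) (upper-self t B) ⟩
    iter k (upper t A ++ t ∷ upper t B)    ≡⟨ eq ⟩
    frontIter k (upper t A) ++ t ∷ R       ∎)
  where open ≡-Reasoning

head-++-above : ∀ {t} X R → All (t <_) X → head (X ++ t ∷ R) ≡ just t → X ≡ []
head-++-above []      R _         _  = refl
head-++-above (x ∷ X) R (t<x ∷ _) eq = contradiction (just-injective eq) (>⇒≢ t<x)

-- By upper-iter-split, frontIter k (upper t A) lists the entries larger than t that still
-- precede t in s^k τ.
Clears : ℕ → List ℕ → Set
Clears k τ = ∀ A t B → τ ≡ A ++ t ∷ B → frontIter k (upper t A) ≡ []

increasing⇒Clears : ∀ k τ → Unique τ → Increasing (iter k τ) → Clears k τ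
increasing⇒Clears k τ u inc A t B refl with tA , R , eq ← upper-iter-split k A t B u =
  head-++-above _ R (frontIter-All k tA)
    (trans (cong head (sym eq)) (sorted⇒upper-head (Linked⇒AllPairs <-trans inc) t∈iter))
  where
  t∈iter : t ∈ iter k (A ++ t ∷ B)
  t∈iter = ∈-resp-↭ (↭-sym (iter-↭ k (A ++ t ∷ B))) (∈-insert A)

Clears⇒increasing : ∀ k τ → Unique τ → Clears k τ → Increasing (iter k τ)
Clears⇒increasing k τ u clears =
  AllPairs⇒Linked (upper-head⇒sorted (Unique-resp-↭ (↭-sym (iter-↭ k τ)) u)
                                      (λ t∈ → head-upper (∈-resp-↭ (iter-↭ k τ) t∈)))
  where
  head-upper : ∀ {t} → t ∈ τ → head (upper t (iter k τ)) ≡ just t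
  head-upper {t} t∈τ with A , B , refl ← ∈-∃++ t∈τ with _ , R , eq ← upper-iter-split k A t B u =
    trans (cong head eq) (cong (λ X → head (X ++ t ∷ R)) (clears A t B refl))

Clears-mono : ∀ {a b} τ → a ≤ b → Clears a τ → Clears b τ
Clears-mono τ a≤b clears A t B eq = frontIter-mono (upper t A) a≤b (clears A t B eq)

Clears-length : ∀ τ → Clears (length τ) τ
Clears-length τ A t B refl =
  frontIter-length _ (upper t A) (≤-trans (length-filter (t ≤?_) A) (length-++-≤ˡ A))

search-increasing : ∀ π fuel start →
                    Increasing (iter (start + fuel) π) → Increasing (iter (search start fuel π) π)
search-increasing π zero start inc = subst (λ k → Increasing (iter k π)) (+-identityʳ start) inc
search-increasing π (suc fuel) start inc with linked? _<?_ (iter start π)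
... | yes inc′ = inc′
... | no _     =
  search-increasing π fuel (suc start) (subst (λ k → Increasing (iter k π)) (+-suc start fuel) inc)

search-least : ∀ π fuel start {j} → start ≤ j → Increasing (iter j π) → search start fuel π ≤ j
search-least π zero start start≤j _ = start≤j
search-least π (suc fuel) start start≤j inc with linked? _<?_ (iter start π)
... | yes _    = start≤j
... | no ¬inc′ = search-least π fuel (suc start) (≤∧≢⇒< start≤j λ { refl → ¬inc′ inc }) inc

sc≤⇔Clears : ∀ k τ → Unique τ → sc τ ≤ k ⇔ Clears k τ
sc≤⇔Clears k τ u = mk⇔
  (λ sc≤k → Clears-mono τ sc≤k (increasing⇒Clears (sc τ) τ u sorted-at-sc))
  (λ clears → search-least τ (length τ) 0 z≤n (Clears⇒increasing k τ u clears))
  where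
  sorted-at-sc : Increasing (iter (sc τ) τ)
  sorted-at-sc = search-increasing τ (length τ) 0 (Clears⇒increasing (length τ) τ u (Clears-length τ))

Clears-++ˡ : ∀ k A B → Clears k (A ++ B) → Clears k A
Clears-++ˡ k A B clears A′ t B′ refl = clears A′ t (B′ ++ B) (++-assoc A′ (t ∷ B′) B)

Clears-upper : ∀ k u τ → Clears k τ → Clears k (upper u τ)
Clears-upper k u τ clears A′ t B′ eq with A , B , τ≡ , refl , u≤t ← filter-split (u ≤?_) τ A′ eq =
  trans (cong (frontIter k) (filter-filter-⊆ (t ≤?_) (u ≤?_) (≤-trans u≤t) A)) (clears A t B τ≡)

Clears-sup : ∀ k π i → Clears k π → Clears k (sup π i)
Clears-sup k π i clears = Clears-upper k (lookup π i) (take (suc (toℕ i)) π)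
  (Clears-++ˡ k _ (drop (suc (toℕ i)) π)
    (subst (Clears k) (sym (take++drop≡id (suc (toℕ i)) π)) clears))

position : (A : List ℕ) (t : ℕ) (B : List ℕ) → Fin (length (A ++ t ∷ B))
position []      t B = zero
position (a ∷ A) t B = suc (position A t B)

lookup-position : ∀ (A : List ℕ) t B → lookup (A ++ t ∷ B) (position A t B) ≡ t
lookup-position []      t B = refl
lookup-position (a ∷ A) t B = lookup-position A t B

take-position : ∀ (A : List ℕ) t B → take (suc (toℕ (position A t B))) (A ++ t ∷ B) ≡ A ++ [ t ]
take-position []      t B = refl
take-position (a ∷ A) t B = cong (a ∷_) (take-position A t B)

sup-position : ∀ A t B → sup (A ++ t ∷ B) (position A t B) ≡ upper t A ++ [ t ]
sup-position A t B = begin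
  sup (A ++ t ∷ B) (position A t B)  ≡⟨ cong₂ upper (lookup-position A t B) (take-position A t B) ⟩
  upper t (A ++ [ t ])               ≡⟨ filter-++ (t ≤?_) A [ t ] ⟩
  upper t A ++ upper t [ t ]         ≡⟨ cong (upper t A ++_) (upper-self t []) ⟩
  upper t A ++ [ t ]                 ∎
  where open ≡-Reasoning

Clears-sups : ∀ k π → (∀ i → Clears k (sup π i)) → Clears k π
Clears-sups k π clears A t B refl = begin
  frontIter k (upper t A)            ≡⟨ cong (frontIter k) (filter-idem (t ≤?_) A) ⟨
  frontIter k (upper t (upper t A))  ≡⟨ clears (position A t B) (upper t A) t [] (sup-position A t B) ⟩
  []                                 ∎
  where open ≡-Reasoning

Unique-sup : ∀ π → Unique π → ∀ i → Unique (sup π i)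
Unique-sup π u i = Unique.filter⁺ (lookup π i ≤?_) (Unique.take⁺ (suc (toℕ i)) u)

sc≤⇔sc-sup≤ : ∀ k π → Unique π → sc π ≤ k ⇔ (∀ i → sc (sup π i) ≤ k)
sc≤⇔sc-sup≤ k π u = mk⇔
  (λ sc≤k i → from (at (sup π i) (Unique-sup π u i)) (Clears-sup k π i (to (at π u) sc≤k)))
  (λ sc-sup≤k → from (at π u)
     (Clears-sups k π λ i → to (at (sup π i) (Unique-sup π u i)) (sc-sup≤k i)))
  where
  open Equivalence
  at : ∀ τ → Unique τ → sc τ ≤ k ⇔ Clears k τ
  at = sc≤⇔Clears k

maximum-≤ : ∀ {n} (f : Fin n → ℕ) {k} → maximum (tabulate f) ≤ k ⇔ (∀ i → f i ≤ k)
maximum-≤ f {k} = mk⇔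
  (λ max≤k → tabulate⁻ (foldr-forcesᵇ {P = _≤ k} ⊔-≤-split 0 (tabulate f) max≤k))
  (λ f≤k → foldr-preservesᵇ {P = _≤ k} ⊔-lub z≤n (tabulate⁺ f≤k))
  where
  ⊔-≤-split : ∀ x y → x ⊔ y ≤ k → x ≤ k × y ≤ k
  ⊔-≤-split x y ⊔≤k = m⊔n≤o⇒m≤o x y ⊔≤k , m⊔n≤o⇒n≤o x y ⊔≤k

theorem1p5 : (n : ℕ) (π : List ℕ) → π ↭ map suc (upTo n) →
    sc π ≡ maxScSup π
theorem1p5 n π π↭ = ≤-antisym (from (bounds (maxScSup π)) ≤-refl) (to (bounds (sc π)) ≤-refl)
  where
  open Equivalence
  distinct : Unique π
  distinct = Unique-resp-↭ (↭-sym π↭) (Unique.map⁺ suc-injective (Unique.upTo⁺ n))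
  bounds : ∀ k → sc π ≤ k ⇔ maxScSup π ≤ k
  bounds k = ⇔-sym (maximum-≤ _) ⇔-∘ sc≤⇔sc-sup≤ k π distinct
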